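{- Let $D$ be a strongly connected digraph and $T$ a DFS tree of $D$ rooted at $r$, and let $t$ be the length of a longest path in $T$. For $0\leq i\leq t$ let $V_i=\{u\in V(D): l(P_u)=i\}$. Then (i) $V(D)=\bigcup_{i=0}^t V_i$, (ii) $V_i\cap V_j=\emptyset$ for $i\neq j$, and (iii) the subdigraph $D\langle V_i\rangle$ induced by $V_i$ is acyclic for every $i$.
   Context: All digraphs are finite and loopless. Strongly connected: directed path between any ordered pair of distinct vertices. A DFS tree $T$ of $D$ rooted at $r$ is the spanning out-branching produced by depth-first search on $D$ from $r$. For a vertex $u$, $P_u$ denotes the unique directed path in $T$ from $r$ to $u$ and $l(P_u)$ its number of arcs. A digraph is acyclic if it contains no directed cycle. -}

module Defs where

open import Data.Nat using (ℕ; zero; suc; _≤_; _≥_)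
open import Data.Fin using (Fin)
open import Data.List using (List; []; _∷_; length; _++_; [_])
open import Data.List.Membership.Propositional using (_∈_; _∉_)
open import Data.List.Relation.Unary.Unique.Propositional using (Unique)
open import Data.Product using (Σ; ∃; _×_; _,_)
open import Relation.Binary.PropositionalEquality using (_≡_; _≢_)
open import Relation.Nullary using (¬_)
open import Data.Empty using (⊥)

record Digraph : Set₁ where
  field
    n        : ℕ
    arc      : Fin n → Fin n → Set
    loopless : ∀ v → ¬ arc v v
open Digraph public

Vertex : Digraph → Set
Vertex D = Fin (n D)

data Chain {V : Set} (R : V → V → Set) : List V → Set where
  c[]  : Chain R []
  c[-] : ∀ {x} → Chain R (x ∷ [])
  c∷   : ∀ {x y vs} → R x y → Chain R (y ∷ vs) → Chain R (x ∷ y ∷ vs)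

-- vs is a directed path (distinct vertices) from x to y w.r.t. arc relation R;
-- its length (number of arcs) is  length vs ∸ 1.
record IsPathFromTo {V : Set} (R : V → V → Set) (x y : V) (vs : List V) : Set where
  field
    start  : Σ (List V) λ ws → vs ≡ x ∷ ws
    finish : Σ (List V) λ ws → vs ≡ ws ++ [ y ]
    chain  : Chain R vs
    unique : Unique vs

HasPathOfLength : {V : Set} → (V → V → Set) → ℕ → Set
HasPathOfLength {V} R k =
  Σ V λ x → Σ V λ y → Σ (List V) λ vs → IsPathFromTo R x y vs × length vs ≡ suc k

IsCycle : {V : Set} → (V → V → Set) → List V → Set
IsCycle R []       = ⊥
IsCycle R (v ∷ vs) = Chain R ((v ∷ vs) ++ [ v ]) × Unique (v ∷ vs)

InducedAcyclic : (D : Digraph) → (Vertex D → Set) → Set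
InducedAcyclic D P = ∀ (vs : List (Vertex D)) → IsCycle (arc D) vs → ¬ (∀ v → v ∈ vs → P v)

StronglyConnected : Digraph → Set
StronglyConnected D =
  ∀ (x y : Vertex D) → x ≢ y → Σ (List (Vertex D)) λ vs → IsPathFromTo (arc D) x y vs

-- Depth-first search, with arbitrary (nondeterministic) choice of the next unvisited
-- out-neighbour.  'DFS D u S E S′ E′' : calling DFS(u) with visited list S and tree-arc
-- list E (u ∉ S) marks u visited and terminates with visited list S′ and tree arcs E′.
-- 'Scan D u S E S′ E′' : the loop over the out-neighbours of u.
module _ (D : Digraph) where
  private V = Vertex D
  data DFS  : V → List V → List (V × V) → List V → List (V × V) → Set
  data Scan : V → List V → List (V × V) → List V → List (V × V) → Set

  data DFS where
    visit : ∀ {u S E S′ E′} → Scan u (u ∷ S) E S′ E′ → DFS u S E S′ E′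

  data Scan where
    done : ∀ {u S E} → (∀ v → arc D u v → v ∈ S) → Scan u S E S E
    step : ∀ {u v S E S₁ E₁ S′ E′} → arc D u v → v ∉ S →
           DFS v S ((u , v) ∷ E) S₁ E₁ → Scan u S₁ E₁ S′ E′ → Scan u S E S′ E′

IsDFSTree : (D : Digraph) → Vertex D → List (Vertex D × Vertex D) → Set
IsDFSTree D r E = Σ (List (Vertex D)) λ S → DFS D r [] [] S E

TreeArc : {V : Set} → List (V × V) → V → V → Set
TreeArc E u v = (u , v) ∈ E

Level : (D : Digraph) → Vertex D → List (Vertex D × Vertex D) → ℕ → Vertex D → Set
Level D r E i u =
  Σ (List (Vertex D)) λ vs → IsPathFromTo (TreeArc E) r u vs × length vs ≡ suc i

IsLongestPathLength : {V : Set} → List (V × V) → ℕ → Set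
IsLongestPathLength E t =
  HasPathOfLength (TreeArc E) t × (∀ k → HasPathOfLength (TreeArc E) k → k ≤ t)

-- Number the vertices in the order DFS discovers them. Tree arcs go from earlier to later
-- vertices and every vertex has at most one tree parent, so the tree path to a vertex is
-- unique and the levels are disjoint; strong connectivity makes DFS visit every vertex,
-- so the levels cover V(D). When DFS finishes a vertex a, each arc a → b leads to a
-- descendant of a or to a vertex discovered before a. If a and b lie on the same level,
-- b cannot be a proper descendant of a, so the arc goes back in discovery order, and a
-- directed cycle inside one level would make the discovery order decrease all the way
-- around.
module Submission where

open import Defs
open import Data.Nat using (ℕ; zero; suc; _+_; _∸_; _≤_; _<_)
open import Data.Nat.Properties
  using (≤-refl; ≤-trans; <-trans; <⇒≤; <⇒≢; <-irrefl; <-≤-trans; n<1+n; m<n⇒m<1+n;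
         n≮0; +-identityʳ; +-cancelˡ-≡; module ≤-Reasoning)
open import Data.Fin.Properties using (_≟_)
open import Data.List using (List; []; _∷_; length; _++_; [_])
open import Data.List.Properties using (∷-injectiveʳ)
open import Data.List.Membership.Propositional using (_∈_; _∉_)
open import Data.List.Membership.Propositional.Properties using (∈-++⁺ʳ)
open import Data.List.Relation.Binary.Subset.Propositional using (_⊆_)
open import Data.List.Relation.Unary.Any using (here; there)
open import Data.List.Relation.Unary.All using (All; []; _∷_)
import Data.List.Relation.Unary.All as All
open import Data.List.Relation.Unary.All.Properties using (++⁺)
open import Data.List.Relation.Unary.AllPairs using ([]; _∷_)
open import Data.Product using (Σ; ∃; _×_; _,_; proj₁; proj₂)
open import Data.Sum using (_⊎_; inj₁; inj₂)
open import Data.Empty using (⊥-elim)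
open import Function using (_∘_)
open import Relation.Binary.Definitions using (DecidableEquality; Transitive)
open import Relation.Nullary using (¬_; yes; no)
open import Relation.Binary.PropositionalEquality
  using (_≡_; _≢_; refl; sym; trans; cong; subst; subst₂)

∉⇒≢ : {A : Set} {v a : A} {S : List A} → v ∉ S → a ∈ S → v ≢ a
∉⇒≢ v∉S a∈S refl = v∉S a∈S

data Walk {V : Set} (R : V → V → Set) : V → V → ℕ → Set where
  ε   : ∀ {x} → Walk R x x 0
  _◅_ : ∀ {x y z k} → R x y → Walk R y z k → Walk R x z (suc k)

infixr 5 _◅_

module _ {V : Set} {R : V → V → Set} where

  infixr 5 _◅◅_

  _◅◅_ : ∀ {x y z k m} → Walk R x y k → Walk R y z m → Walk R x z (k + m)
  ε       ◅◅ q = q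
  (a ◅ p) ◅◅ q = a ◅ (p ◅◅ q)

  walk₀⇒≡ : ∀ {x y} → Walk R x y 0 → x ≡ y
  walk₀⇒≡ ε = refl

  unsnoc : ∀ {x z k} → Walk R x z (suc k) → Σ V λ y → Walk R x y k × R y z
  unsnoc (a ◅ ε)       = _ , ε , a
  unsnoc (a ◅ b ◅ p) with unsnoc (b ◅ p)
  ... | y , q , c = y , a ◅ q , c

  walk-preserves : (P : V → Set) → (∀ {a b} → R a b → P a → P b) →
                   ∀ {x y k} → Walk R x y k → P x → P y
  walk-preserves P closed ε       px = px
  walk-preserves P closed (a ◅ p) px = walk-preserves P closed p (closed a px)

  walk-length-unique : (∀ {a a′ b} → R a b → R a′ b → a ≡ a′) →
                       ∀ {r} → (∀ {a} → ¬ R a r) →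
                       ∀ {u k k′} → Walk R r u k → Walk R r u k′ → k ≡ k′
  walk-length-unique pred-unique no-arc {k = zero}  {zero}   _ _ = refl
  walk-length-unique pred-unique no-arc {k = zero}  {suc _}  ε q =
    ⊥-elim (no-arc (proj₂ (proj₂ (unsnoc q))))
  walk-length-unique pred-unique no-arc {k = suc _} {zero}   p ε =
    ⊥-elim (no-arc (proj₂ (proj₂ (unsnoc p))))
  walk-length-unique pred-unique no-arc {k = suc k} {suc k′} p q
    with unsnoc p | unsnoc q
  ... | y , p′ , a | y′ , q′ , b with refl ← pred-unique a b =
    cong suc (walk-length-unique pred-unique no-arc p′ q′)

  chain⇒walk : ∀ {x y} ws zs → Chain R (x ∷ ws) → x ∷ ws ≡ zs ++ [ y ] →
               Walk R x y (length ws)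
  chain⇒walk []       []           c[-]       refl = ε
  chain⇒walk []       (_ ∷ [])     _          ()
  chain⇒walk []       (_ ∷ _ ∷ _)  _          ()
  chain⇒walk (w ∷ ws) (z ∷ zs)     (c∷ a ch)  eq   = a ◅ chain⇒walk ws zs ch (∷-injectiveʳ eq)

  path⇒walk : ∀ {x y vs} → IsPathFromTo R x y vs → Walk R x y (length vs ∸ 1)
  path⇒walk record { start = ws , refl ; finish = zs , eq ; chain = ch } = chain⇒walk ws zs ch eq

  -- The bound f x ≤ f w on the path's vertices keeps each new head distinct from the rest.
  walk⇒path : (f : V → ℕ) → (∀ {a b} → R a b → f a < f b) → ∀ {x y k} → Walk R x y k →
              Σ (List V) λ vs → IsPathFromTo R x y vs × length vs ≡ suc k × All (λ w → f x ≤ f w) vs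
  walk⇒path f increasing {x} ε =
    [ x ] , record { start = [] , refl ; finish = [] , refl ; chain = c[-] ; unique = [] ∷ [] }
          , refl , ≤-refl ∷ []
  walk⇒path f increasing {x} (a ◅ p) with walk⇒path f increasing p
  ... | vs , record { start = ws , refl ; finish = zs , eq ; chain = ch ; unique = un } , len , bounds =
    x ∷ vs , record { start  = vs , refl
                    ; finish = x ∷ zs , cong (x ∷_) eq
                    ; chain  = c∷ a ch
                    ; unique = All.map (λ fy≤fw → <⇒≢ (<-≤-trans (increasing a) fy≤fw) ∘ cong f) bounds ∷ un }
           , cong suc len , ≤-refl ∷ All.map (≤-trans (<⇒≤ (increasing a))) bounds

  walk-map : {R′ : V → V → Set} → (∀ {a b} → R a b → R′ a b) →
             ∀ {x y k} → Walk R x y k → Walk R′ x y k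
  walk-map f ε       = ε
  walk-map f (a ◅ p) = f a ◅ walk-map f p

  chain-map : {R′ : V → V → Set} (P : V → Set) → (∀ {a b} → P a → P b → R a b → R′ a b) →
              ∀ {vs} → All P vs → Chain R vs → Chain R′ vs
  chain-map P f _                c[]        = c[]
  chain-map P f _                c[-]       = c[-]
  chain-map P f (pa ∷ pb ∷ pvs) (c∷ a ch)  = c∷ (f pa pb a) (chain-map P f (pb ∷ pvs) ch)

  chain-from-head : Transitive R → ∀ {x y ys} → Chain R (x ∷ ys) → y ∈ ys → R x y
  chain-from-head R-trans (c∷ a ch) (here refl) = a
  chain-from-head R-trans (c∷ a ch) (there y∈)  = R-trans a (chain-from-head R-trans ch y∈)

module DiscoveryTime {A : Set} (_≟_ : DecidableEquality A) where

  -- The number of entries after the first occurrence of x: for a list grown by consing it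
  -- is the position at which x was added and never changes afterwards. Junk value 0 if x ∉ S.
  time : List A → A → ℕ
  time []      x = 0
  time (s ∷ S) x with s ≟ x
  ... | yes _ = length S
  ... | no  _ = time S x

  time-head : ∀ u S → time (u ∷ S) u ≡ length S
  time-head u S with u ≟ u
  ... | yes _ = refl
  ... | no u≢u = ⊥-elim (u≢u refl)

  time-tail : ∀ {u x} S → u ≢ x → time (u ∷ S) x ≡ time S x
  time-tail {u} {x} S u≢x with u ≟ x
  ... | yes u≡x = ⊥-elim (u≢x u≡x)
  ... | no  _   = refl

  time-< : ∀ {x S} → x ∈ S → time S x < length S
  time-< {x} {s ∷ S} x∈ with s ≟ x | x∈
  ... | yes _   | _          = n<1+n (length S)
  ... | no  s≢x | here x≡s   = ⊥-elim (s≢x (sym x≡s))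
  ... | no  _   | there x∈S  = m<n⇒m<1+n (time-< x∈S)

module DFSInvariants (D : Digraph) where

  private
    V = Vertex D

  open DiscoveryTime (_≟_ {n D})

  record TreeInvariant (S : List V) (E : List (V × V)) : Set where
    field
      ordered       : ∀ {a b} → (a , b) ∈ E → a ∈ S × b ∈ S × time S a < time S b
      parent-unique : ∀ {a a′ b} → (a , b) ∈ E → (a′ , b) ∈ E → a ≡ a′

  treeInvariant-∷ : ∀ {S E u v} → TreeInvariant S E → u ∈ S → v ∉ S →
                    TreeInvariant (v ∷ S) ((u , v) ∷ E)
  TreeInvariant.ordered (treeInvariant-∷ {S} {v = v} I u∈ v∉) (here refl) =
    there u∈ , here refl , subst₂ _<_ (sym (time-tail S (∉⇒≢ v∉ u∈))) (sym (time-head v S)) (time-< u∈)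
  TreeInvariant.ordered (treeInvariant-∷ {S} I u∈ v∉) (there e) with TreeInvariant.ordered I e
  ... | a∈ , b∈ , a<b = there a∈ , there b∈ ,
    subst₂ _<_ (sym (time-tail S (∉⇒≢ v∉ a∈))) (sym (time-tail S (∉⇒≢ v∉ b∈))) a<b
  TreeInvariant.parent-unique (treeInvariant-∷ I u∈ v∉) (here refl) (here refl) = refl
  TreeInvariant.parent-unique (treeInvariant-∷ I u∈ v∉) (here refl) (there e) =
    ⊥-elim (v∉ (proj₁ (proj₂ (TreeInvariant.ordered I e))))
  TreeInvariant.parent-unique (treeInvariant-∷ I u∈ v∉) (there e) (here refl) =
    ⊥-elim (v∉ (proj₁ (proj₂ (TreeInvariant.ordered I e))))
  TreeInvariant.parent-unique (treeInvariant-∷ I u∈ v∉) (there e) (there e′) =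
    TreeInvariant.parent-unique I e e′

  Extends : List V → List V → Set
  Extends S S′ = ∀ {x} → x ∈ S → x ∈ S′ × time S′ x ≡ time S x

  extends-∷ : ∀ {S u} → u ∉ S → Extends S (u ∷ S)
  extends-∷ {S} u∉ x∈ = there x∈ , time-tail S (∉⇒≢ u∉ x∈)

  extends-trans : ∀ {S S₁ S₂} → Extends S S₁ → Extends S₁ S₂ → Extends S S₂
  extends-trans f g x∈ = proj₁ (g (proj₁ (f x∈))) , trans (proj₂ (g (proj₁ (f x∈)))) (proj₂ (f x∈))

  Descendant : List (V × V) → V → V → Set
  Descendant E x y = ∃ (Walk (TreeArc E) x y)

  Finished : List V → List (V × V) → V → Set
  Finished S E w = ∀ y → arc D w y → y ∈ S × (Descendant E w y ⊎ time S y < time S w)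

  finished-mono : ∀ {S S′ E E′ w} → Extends S S′ → E ⊆ E′ → w ∈ S →
                  Finished S E w → Finished S′ E′ w
  finished-mono ext E⊆E′ w∈ fin y a with fin y a
  ... | y∈ , inj₁ (k , p) = proj₁ (ext y∈) , inj₁ (k , walk-map E⊆E′ p)
  ... | y∈ , inj₂ y<w     =
    proj₁ (ext y∈) , inj₂ (subst₂ _<_ (sym (proj₂ (ext y∈))) (sym (proj₂ (ext w∈))) y<w)

  Explored : List V → List V → List (V × V) → V → Set
  Explored S S′ E′ u = ∀ {x} → x ∈ S′ → x ∈ S ⊎ (Descendant E′ u x × Finished S′ E′ x)

  record ScanOutcome (u : V) (S : List V) (E : List (V × V)) (S′ : List V) (E′ : List (V × V)) : Set where
    field
      invariant          : TreeInvariant S′ E′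
      extends            : Extends S S′
      arcs-grow          : E ⊆ E′
      neighbours-visited : ∀ y → arc D u y → y ∈ S′
      explored           : Explored S S′ E′ u

  record DFSOutcome (u : V) (S : List V) (E : List (V × V)) (S′ : List V) (E′ : List (V × V)) : Set where
    field
      invariant  : TreeInvariant S′ E′
      extends    : Extends S S′
      arcs-grow  : E ⊆ E′
      visited    : u ∈ S′
      discovered : time S′ u ≡ length S
      explored   : Explored S S′ E′ u

  scan-outcome : ∀ {u S E S′ E′} → Scan D u S E S′ E′ → u ∈ S → TreeInvariant S E →
                 ScanOutcome u S E S′ E′
  dfs-outcome  : ∀ {u S E S′ E′} → DFS D u S E S′ E′ → u ∉ S → TreeInvariant (u ∷ S) E →
                 DFSOutcome u S E S′ E′

  scan-outcome (done neighbours-visited) u∈ I = record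
    { invariant = I ; extends = λ x∈ → x∈ , refl ; arcs-grow = λ e → e
    ; neighbours-visited = neighbours-visited ; explored = inj₁ }
  scan-outcome {u} {S} {E} {S′} {E′} (step {v = v} a v∉ dfs scan) u∈ I = record
    { invariant = Rest.invariant ; extends = extends-trans Child.extends Rest.extends
    ; arcs-grow = Rest.arcs-grow ∘ Child.arcs-grow ∘ there
    ; neighbours-visited = Rest.neighbours-visited ; explored = explored }
    where
      module Child = DFSOutcome (dfs-outcome dfs v∉ (treeInvariant-∷ I u∈ v∉))
      module Rest  = ScanOutcome (scan-outcome scan (proj₁ (Child.extends u∈)) Child.invariant)
      explored : Explored S S′ E′ u
      explored x∈ with Rest.explored x∈
      ... | inj₂ new = inj₂ new
      ... | inj₁ x∈₁ with Child.explored x∈₁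
      ...   | inj₁ x∈S = inj₁ x∈S
      ...   | inj₂ ((k , p) , fin) =
        inj₂ ( (suc k , Rest.arcs-grow (Child.arcs-grow (here refl)) ◅ walk-map Rest.arcs-grow p)
             , finished-mono Rest.extends Rest.arcs-grow x∈₁ fin)

  dfs-outcome {u} {S} {E} {S′} {E′} (visit scan) u∉ I = record
    { invariant = Loop.invariant ; extends = extends-trans (extends-∷ u∉) Loop.extends
    ; arcs-grow = Loop.arcs-grow ; visited = proj₁ (Loop.extends (here refl))
    ; discovered = discovered ; explored = explored }
    where
      module Loop = ScanOutcome (scan-outcome scan (here refl) I)
      discovered : time S′ u ≡ length S
      discovered = trans (proj₂ (Loop.extends (here refl))) (time-head u S)
      earlier : ∀ {y} → y ∈ S → time S′ y < time S′ u
      earlier {y} y∈S = begin-strict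
        time S′ y        ≡⟨ proj₂ (Loop.extends (there y∈S)) ⟩
        time (u ∷ S) y   ≡⟨ time-tail S (∉⇒≢ u∉ y∈S) ⟩
        time S y         <⟨ time-< y∈S ⟩
        length S         ≡⟨ sym discovered ⟩
        time S′ u        ∎
        where open ≤-Reasoning
      u-finished : Finished S′ E′ u
      u-finished y a with Loop.explored (Loop.neighbours-visited y a)
      ... | inj₁ (here refl)  = ⊥-elim (loopless D u a)
      ... | inj₁ (there y∈S)  = Loop.neighbours-visited y a , inj₂ (earlier y∈S)
      ... | inj₂ (desc , _)   = Loop.neighbours-visited y a , inj₁ desc
      explored : Explored S S′ E′ u
      explored x∈ with Loop.explored x∈
      ... | inj₁ (here refl) = inj₂ ((0 , ε) , u-finished)
      ... | inj₁ (there x∈S) = inj₁ x∈S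
      ... | inj₂ new         = inj₂ new

module DFSTree {D : Digraph} {r : Vertex D} {E : List (Vertex D × Vertex D)}
               (tree : IsDFSTree D r E) where

  open DFSInvariants D
  open DiscoveryTime (_≟_ {n D})

  private
    S : List (Vertex D)
    S = proj₁ tree

    initial : TreeInvariant [ r ] []
    initial = record { ordered = λ () ; parent-unique = λ () }

    module Root = DFSOutcome (dfs-outcome (proj₂ tree) (λ ()) initial)

  visited⇒finished : ∀ {x} → x ∈ S → Descendant E r x × Finished S E x
  visited⇒finished x∈ with Root.explored x∈
  ... | inj₁ ()
  ... | inj₂ descendant-finished = descendant-finished

  treeArc-ordered : ∀ {a b} → TreeArc E a b → time S a < time S b
  treeArc-ordered e = proj₂ (proj₂ (TreeInvariant.ordered Root.invariant e))

  no-treeArc-into-root : ∀ {a} → ¬ TreeArc E a r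
  no-treeArc-into-root e = n≮0 (subst (_ <_) Root.discovered (treeArc-ordered e))

  treeWalk-length-unique : ∀ {u k k′} → Walk (TreeArc E) r u k → Walk (TreeArc E) r u k′ → k ≡ k′
  treeWalk-length-unique =
    walk-length-unique (TreeInvariant.parent-unique Root.invariant) no-treeArc-into-root

  treeWalk⇒visited : ∀ {u k} → Walk (TreeArc E) r u k → u ∈ S
  treeWalk⇒visited p =
    walk-preserves (_∈ S) (λ e _ → proj₁ (proj₂ (TreeInvariant.ordered Root.invariant e))) p Root.visited

  level⇒walk : ∀ {i u} → Level D r E i u → Walk (TreeArc E) r u i
  level⇒walk {u = u} (vs , path , len) = subst (Walk (TreeArc E) r u) (cong (_∸ 1) len) (path⇒walk path)

  walk⇒level : ∀ {i u} → Walk (TreeArc E) r u i → Level D r E i u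
  walk⇒level p with walk⇒path (time S) treeArc-ordered p
  ... | vs , path , len , _ = vs , path , len

  level-unique : (i j : ℕ) (u : Vertex D) → Level D r E i u → Level D r E j u → i ≡ j
  level-unique i j u lᵢ lⱼ = treeWalk-length-unique (level⇒walk lᵢ) (level⇒walk lⱼ)

  same-level-arc-backward : ∀ {i a b} → Level D r E i a → Level D r E i b → arc D a b →
                            time S b < time S a
  same-level-arc-backward {i} {a} {b} a-level b-level ab
    with proj₂ (visited⇒finished (treeWalk⇒visited (level⇒walk a-level))) b ab
  ... | _ , inj₂ b<a       = b<a
  ... | _ , inj₁ (m , a⇝b) = ⊥-elim (loopless D a (subst (arc D a) (sym a≡b) ab))
    where
      -- b would have tree walks from r of lengths i + m and i.
      m≡0 : m ≡ 0
      m≡0 = +-cancelˡ-≡ i m 0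
              (trans (treeWalk-length-unique (level⇒walk a-level ◅◅ a⇝b) (level⇒walk b-level))
                     (sym (+-identityʳ i)))
      a≡b : a ≡ b
      a≡b = walk₀⇒≡ (subst (Walk (TreeArc E) a b) m≡0 a⇝b)

  level-acyclic : ∀ i → InducedAcyclic D (Level D r E i)
  level-acyclic i []       ()
  level-acyclic i (v ∷ vs) (cycle , _) inLevel =
    <-irrefl refl (chain-from-head (λ x y → <-trans y x) descending (∈-++⁺ʳ vs (here refl)))
    where
      descending : Chain (λ a b → time S b < time S a) (v ∷ vs ++ [ v ])
      descending = chain-map (Level D r E i) same-level-arc-backward
                     (++⁺ (All.tabulate (inLevel _)) (inLevel v (here refl) ∷ [])) cycle

  visited-all : StronglyConnected D → ∀ v → v ∈ S
  visited-all sc v with v ≟ r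
  ... | yes refl = Root.visited
  ... | no  v≢r  =
    walk-preserves (_∈ S) (λ a x∈ → proj₁ (proj₂ (visited⇒finished x∈) _ a))
      (path⇒walk (proj₂ (sc r v (v≢r ∘ sym)))) Root.visited

  level-exists : StronglyConnected D → ∀ u → ∃ λ i → Level D r E i u
  level-exists sc u with proj₁ (visited⇒finished (visited-all sc u))
  ... | k , r⇝u = k , walk⇒level r⇝u

lemma4 : (D : Digraph) → StronglyConnected D →
    (r : Vertex D) (E : List (Vertex D × Vertex D)) → IsDFSTree D r E →
    (t : ℕ) → IsLongestPathLength E t →
    ((u : Vertex D) → Σ ℕ λ i → i ≤ t × Level D r E i u)
    × ((i j : ℕ) (u : Vertex D) → Level D r E i u → Level D r E j u → i ≡ j)
    × ((i : ℕ) → i ≤ t → InducedAcyclic D (Level D r E i))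
lemma4 D sc r E tree t (_ , longest) =
    (λ u → let i , lᵢ = level-exists sc u in i , longest i (r , u , lᵢ) , lᵢ)
  , level-unique
  , λ i _ → level-acyclic i
  where open DFSTree tree
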